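{- Let $Z$ be a set, $\mathcal{Y}\subseteq\mathcal{P}(Z)$ closed under arbitrary intersections and finite unions, containing all singletons, with $\emptyset,Z\in\mathcal{Y}$, and let $\mu:\mathcal{Y}\to\mathcal{Y}$. (a) If $\mu$ satisfies $(\mu=)$ for finite sets, $(\mu\in)$, $(\mu PR3)$ and $(\mu\emptyset fin)$, then there is a ranked preferential structure $\mathcal{Z}$ without copies over $Z$ such that $\mu(U)=\overbrace{\mu_{\mathcal{Z}}(U)}$ for all $U\in\mathcal{Y}$. (b) If $\mathcal{Z}$ is a ranked preferential structure over $Z$ without copies and $\mu(U)=\overbrace{\mu_{\mathcal{Z}}(U)}$ for all $U\in\mathcal{Y}$, then $\mu$ satisfies $(\mu=)$ for finite sets, $(\mu\in)$, $(\mu PR3)$ and $(\mu\emptyset fin)$.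
   Context: A ranked preferential structure without copies over $Z$ is $\langle Z,\prec\rangle$ with $\prec$ ranked: there is a map $f$ from $Z$ into a strictly totally ordered set $(O,<_O)$ with $u\prec u'$ iff $f(u)<_O f(u')$. $\mu_{\mathcal{Z}}(X):=\{x\in X:\neg\exists x'\in X.\,x'\prec x\}$. For $A\subseteq Z$, $\overbrace{A}:=\bigcap\{X\in\mathcal{Y}:A\subseteq X\}$. For $B\in\mathcal{Y}$ and $A\subseteq B$, $A$ is small in $B$ iff no $X\in\mathcal{Y}$ satisfies $B-A\subseteq X\subsetneq B$. $\mu_3(U):=\{x\in U:\forall y\in U.\,x\in\mu(\{x,y\})\}$. Conditions (sets in $\mathcal{Y}$): $(\mu=)$ for finite sets: for finite $X\subseteq Y$, $\mu(Y)\cap X\neq\emptyset\Rightarrow\mu(Y)\cap X=\mu(X)$; $(\mu\in)$: $a\in X-\mu(X)\Rightarrow\exists b\in X.\,a\notin\mu(\{a,b\})$; $(\mu\emptyset fin)$: $X$ finite nonempty $\Rightarrow\mu(X)\neq\emptyset$; $(\mu PR3)$: for every $U\in\mathcal{Y}$, $\mu(U)-\mu_3(U)$ is small in $\mu(U)$. -}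

module Defs where

open import Level using (Level; _⊔_; suc; Lift; Setω)
open import Data.Empty using (⊥)
open import Data.Unit using (⊤)
open import Data.Product using (Σ; ∃; _×_; _,_)
open import Data.List using (List)
import Data.List.Membership.Propositional as LMem
open import Relation.Nullary using (¬_)
open import Relation.Unary using (Pred; _∈_; _∉_; _⊆_; _∪_; _∩_; _≐_; ∁; Satisfiable)
open import Relation.Binary using (Rel)
open import Relation.Binary.Bundles using (StrictTotalOrder)
open import Relation.Binary.PropositionalEquality using (_≡_)
open import Function.Bundles using (_⇔_)

module _ {ℓ : Level} {Z : Set ℓ} where

  ∅ℓ : Pred Z ℓ
  ∅ℓ = λ _ → Lift ℓ ⊥

  Zℓ : Pred Z ℓ
  Zℓ = λ _ → Lift ℓ ⊤

  ⟦_⟧ : Z → Pred Z ℓ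
  ⟦ a ⟧ = λ x → x ≡ a

  pair : Z → Z → Pred Z ℓ
  pair a b = ⟦ a ⟧ ∪ ⟦ b ⟧

  _─_ : ∀ {ℓ₁ ℓ₂} → Pred Z ℓ₁ → Pred Z ℓ₂ → Pred Z (ℓ₁ ⊔ ℓ₂)
  B ─ A = B ∩ ∁ A

  Finite : ∀ {ℓ₁} → Pred Z ℓ₁ → Set (ℓ ⊔ ℓ₁)
  Finite X = Σ (List Z) λ xs → ∀ x → (x ∈ X) ⇔ (x LMem.∈ xs)

  -- 𝒴 is a family of *sets*: membership is invariant under extensional equality
  Extensional : ∀ {ℓy} → Pred (Pred Z ℓ) ℓy → Set (suc ℓ ⊔ ℓy)
  Extensional 𝒴 = ∀ X X′ → X ≐ X′ → X ∈ 𝒴 → X′ ∈ 𝒴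

  ClosedUnderIntersections : ∀ {ℓy} → Pred (Pred Z ℓ) ℓy → Setω
  ClosedUnderIntersections 𝒴 =
    ∀ {ι} (𝒳 : Pred (Pred Z ℓ) ι) → 𝒳 ⊆ 𝒴 →
    Σ (Pred Z ℓ) λ W → (W ∈ 𝒴) × (∀ x → (x ∈ W) ⇔ (∀ X → X ∈ 𝒳 → x ∈ X))

  ClosedUnderFiniteUnions : ∀ {ℓy} → Pred (Pred Z ℓ) ℓy → Set (suc ℓ ⊔ ℓy)
  ClosedUnderFiniteUnions 𝒴 = ∀ X X′ → X ∈ 𝒴 → X′ ∈ 𝒴 → (X ∪ X′) ∈ 𝒴

  ContainsSingletons : ∀ {ℓy} → Pred (Pred Z ℓ) ℓy → Set (ℓ ⊔ ℓy)
  ContainsSingletons 𝒴 = ∀ a → ⟦ a ⟧ ∈ 𝒴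

  -- μ : 𝒴 → 𝒴, modelled as a map on subsets that sends 𝒴 into 𝒴 and
  -- respects extensional equality of sets in 𝒴 (so it is a function on sets)
  IsChoiceFunction : ∀ {ℓy} → Pred (Pred Z ℓ) ℓy → (Pred Z ℓ → Pred Z ℓ) → Set (suc ℓ ⊔ ℓy)
  IsChoiceFunction 𝒴 μ =
    (∀ X → X ∈ 𝒴 → μ X ∈ 𝒴) × (∀ X X′ → X ∈ 𝒴 → X ≐ X′ → μ X ≐ μ X′)

  module _ {ℓy} (𝒴 : Pred (Pred Z ℓ) ℓy) (μ : Pred Z ℓ → Pred Z ℓ) where

    μ=fin : Set (suc ℓ ⊔ ℓy)
    μ=fin = ∀ X Y → X ∈ 𝒴 → Y ∈ 𝒴 → Finite X → Finite Y → X ⊆ Y →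
            Satisfiable (μ Y ∩ X) → (μ Y ∩ X) ≐ μ X

    μ∈ : Set (suc ℓ ⊔ ℓy)
    μ∈ = ∀ X → X ∈ 𝒴 → ∀ a → a ∈ (X ─ μ X) → ∃ λ b → b ∈ X × a ∉ μ (pair a b)

    μ∅fin : Set (suc ℓ ⊔ ℓy)
    μ∅fin = ∀ X → X ∈ 𝒴 → Finite X → Satisfiable X → Satisfiable (μ X)

    μ₃ : Pred Z ℓ → Pred Z ℓ
    μ₃ U = λ x → x ∈ U × (∀ y → y ∈ U → x ∈ μ (pair x y))

    Small : ∀ {ℓa} → Pred Z ℓa → Pred Z ℓ → Set (suc ℓ ⊔ ℓy ⊔ ℓa)
    Small A B = ¬ (Σ (Pred Z ℓ) λ X → X ∈ 𝒴 × (B ─ A) ⊆ X × X ⊆ B × ¬ (B ⊆ X))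

    μPR3 : Set (suc ℓ ⊔ ℓy)
    μPR3 = ∀ U → U ∈ 𝒴 → Small (μ U ─ μ₃ U) (μ U)

    AllConditions : Set (suc ℓ ⊔ ℓy)
    AllConditions = μ=fin × μ∈ × μPR3 × μ∅fin

    IsOverbrace : ∀ {ℓa ℓb} → Pred Z ℓa → Pred Z ℓb → Set (suc ℓ ⊔ ℓy ⊔ ℓa ⊔ ℓb)
    IsOverbrace A B = ∀ x → (x ∈ B) ⇔ (∀ X → X ∈ 𝒴 → A ⊆ X → x ∈ X)

record RankedStructure {ℓ} (Z : Set ℓ) (o₁ o₂ o₃ r : Level)
       : Set (ℓ ⊔ suc (o₁ ⊔ o₂ ⊔ o₃ ⊔ r)) where
  field
    _≺_    : Rel Z r
    order  : StrictTotalOrder o₁ o₂ o₃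
    f      : Z → StrictTotalOrder.Carrier order
    ranked : ∀ u u′ → (u ≺ u′) ⇔ StrictTotalOrder._<_ order (f u) (f u′)

  μ𝒵 : ∀ {ℓx} → Pred Z ℓx → Pred Z (ℓ ⊔ ℓx ⊔ r)
  μ𝒵 X = λ x → x ∈ X × ¬ (∃ λ x′ → x′ ∈ X × x′ ≺ x)

open RankedStructure public using (μ𝒵)

{-# OPTIONS --safe #-}
module Submission where

-- (a) Read a preference off the choices on pairs: x ≼ y iff x ∈ μ{x,y}.
-- (μ∅fin) makes ≼ total and (μ=) on three-element sets makes it
-- transitive, so its strict part ranks Z, and the minimal elements of U
-- are exactly μ₃(U).  By (μ∈), μ₃(U) ⊆ μ(U); and if X ∈ 𝒴 contains
-- μ₃(U), then μ(U) ∩ X ∈ 𝒴 contains μ(U) - (μ(U) - μ₃(U)), so by (μPR3)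
-- it is all of μ(U).  Hence μ(U) is the least 𝒴-set containing μ₃(U).
-- (b) Every subset of a finite set is a finite union of singletons, hence
-- in 𝒴, so μ coincides with μ𝒵 on finite sets of 𝒴, where the finite conditions
-- hold because 𝒵 is ranked.  (μ∈) is witnessed by a pair {a, b} with
-- b ≺ a, and (μPR3) holds because μ𝒵(U) ⊆ μ₃(U).

open import Defs
open import Level using (Level; lift)
open import Data.Empty using (⊥-elim)
open import Data.List using (List; []; _∷_; _++_)
open import Data.List.Membership.Propositional using () renaming (_∈_ to _∈ₗ_)
open import Data.List.Membership.Propositional.Properties using (∈-++⁺ˡ; ∈-++⁺ʳ; ∈-++⁻)
open import Data.List.Relation.Unary.Any using (here; there)
open import Data.List.Relation.Unary.Any.Properties using (singleton⁻)
open import Data.Product using (Σ; Σ-syntax; ∃; _×_; _,_; proj₁; proj₂; map₂)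
open import Data.Sum using (_⊎_; inj₁; inj₂; [_,_])
open import Function using (id; _∘_)
open import Function.Bundles using (mk⇔; Equivalence)
open import Relation.Binary using (Rel; Total; Transitive; Decidable; Tri; tri<; tri≈; tri>)
open import Relation.Binary.Bundles using (StrictTotalOrder)
open import Relation.Binary.PropositionalEquality using (_≡_; refl)
open import Relation.Nullary using (¬_; Dec; yes; no)
open import Relation.Nullary.Decidable using (decidable-stable; map′)
open import Relation.Unary using (Pred; _∈_; _⊆_; _∪_; _∩_; _≐_; Satisfiable)
open import Relation.Unary.Algebra using (∪-comm)
open import Axiom.ExcludedMiddle using (ExcludedMiddle)

module _ {ℓ : Level} {Z : Set ℓ} where

  ⟦⟧-finite : (a : Z) → Finite ⟦ a ⟧
  ⟦⟧-finite a = a ∷ [] , λ x → mk⇔ here singleton⁻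

  ∪-finite : ∀ {ℓ₁ ℓ₂} {X : Pred Z ℓ₁} {Y : Pred Z ℓ₂} → Finite X → Finite Y → Finite (X ∪ Y)
  ∪-finite (xs , X⇔xs) (ys , Y⇔ys) = xs ++ ys , λ x →
    mk⇔ [ ∈-++⁺ˡ ∘ Equivalence.to (X⇔xs x) , ∈-++⁺ʳ xs ∘ Equivalence.to (Y⇔ys x) ]
        ([ inj₁ ∘ Equivalence.from (X⇔xs x) , inj₂ ∘ Equivalence.from (Y⇔ys x) ] ∘ ∈-++⁻ xs)

  pair-finite : (a b : Z) → Finite (pair a b)
  pair-finite a b = ∪-finite (⟦⟧-finite a) (⟦⟧-finite b)

module _ {ℓ ℓy : Level} {Z : Set ℓ} {𝒴 : Pred (Pred Z ℓ) ℓy} where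

  pair∈𝒴 : ClosedUnderFiniteUnions 𝒴 → ContainsSingletons 𝒴 → (a b : Z) → pair a b ∈ 𝒴
  pair∈𝒴 cup sing a b = cup _ _ (sing a) (sing b)

  ∩∈𝒴 : ClosedUnderIntersections 𝒴 → ∀ {X Y} → X ∈ 𝒴 → Y ∈ 𝒴 →
        Σ[ W ∈ Pred Z ℓ ] W ∈ 𝒴 × W ≐ (X ∩ Y)
  ∩∈𝒴 cap {X} {Y} X∈ Y∈ with cap (λ V → V ≡ X ⊎ V ≡ Y) [ (λ { refl → X∈ }) , (λ { refl → Y∈ }) ]
  ... | W , W∈ , W⇔ =
    W , W∈ , (λ w → let w∈ = Equivalence.to (W⇔ _) w in w∈ X (inj₁ refl) , w∈ Y (inj₂ refl))
           , (λ { (x , y) → Equivalence.from (W⇔ _) λ { _ (inj₁ refl) → x ; _ (inj₂ refl) → y } })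

  module _ (lem : ∀ {a} → ExcludedMiddle a) (∅∈ : ∅ℓ ∈ 𝒴)
           (cup : ClosedUnderFiniteUnions 𝒴) (sing : ContainsSingletons 𝒴) where

    private
      Listed : ∀ {p} → Pred Z p → List Z → Set _
      Listed P xs = Σ[ S ∈ Pred Z ℓ ] S ∈ 𝒴 × S ≐ (P ∩ (_∈ₗ xs))

    listed∈𝒴 : ∀ {p} (P : Pred Z p) xs → Listed P xs
    listed∈𝒴 P [] = ∅ℓ , ∅∈ , (λ { (lift ()) }) , (λ { (_ , ()) })
    listed∈𝒴 P (x ∷ xs) = extend lem (listed∈𝒴 P xs)
      where
      extend : Dec (P x) → Listed P xs → Listed P (x ∷ xs)
      extend (yes px) (S , S∈ , S⊆ , S⊇) =
        ⟦ x ⟧ ∪ S , cup _ _ (sing x) S∈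
        , (λ { (inj₁ refl) → px , here refl ; (inj₂ s) → map₂ there (S⊆ s) })
        , (λ { (_ , here refl) → inj₁ refl ; (p , there m) → inj₂ (S⊇ (p , m)) })
      extend (no ¬px) (S , S∈ , S⊆ , S⊇) =
        S , S∈ , map₂ there ∘ S⊆
        , (λ { (p , here refl) → ⊥-elim (¬px p) ; (p , there m) → S⊇ (p , m) })

    finite-subset∈𝒴 : ∀ {p ℓx} {P : Pred Z p} {X : Pred Z ℓx} → Finite X → P ⊆ X →
                      Σ[ S ∈ Pred Z ℓ ] S ∈ 𝒴 × S ≐ P
    finite-subset∈𝒴 {P = P} (xs , X⇔xs) P⊆X with listed∈𝒴 P xs
    ... | S , S∈ , S⊆ , S⊇ = S , S∈ , proj₁ ∘ S⊆ , λ p → S⊇ (p , Equivalence.to (X⇔xs _) (P⊆X p))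

module Overbrace {ℓ ℓy : Level} {Z : Set ℓ} (𝒴 : Pred (Pred Z ℓ) ℓy) (μ : Pred Z ℓ → Pred Z ℓ)
                 {ℓa : Level} {A : Pred Z ℓa} where

  IsOverbrace⇒⊆ : ∀ {ℓb} {B : Pred Z ℓb} → IsOverbrace 𝒴 μ A B → A ⊆ B
  IsOverbrace⇒⊆ A⌢B {x} a = Equivalence.from (A⌢B x) λ X _ A⊆X → A⊆X a

  IsOverbrace⇒least : ∀ {ℓb} {B : Pred Z ℓb} → IsOverbrace 𝒴 μ A B →
                      ∀ {X} → X ∈ 𝒴 → A ⊆ X → B ⊆ X
  IsOverbrace⇒least A⌢B {X} X∈ A⊆X b = Equivalence.to (A⌢B _) b X X∈ A⊆X

  least⇒IsOverbrace : ∀ {B} → B ∈ 𝒴 → A ⊆ B → (∀ {X} → X ∈ 𝒴 → A ⊆ X → B ⊆ X) →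
                      IsOverbrace 𝒴 μ A B
  least⇒IsOverbrace {B} B∈ A⊆B least x =
    mk⇔ (λ b X X∈ (A⊆X : A ⊆ X) → least X∈ A⊆X b) (λ h → h B B∈ A⊆B)

module RankedStructureProperties {ℓ o₁ o₂ o₃ r : Level} {Z : Set ℓ}
                                 (𝒵 : RankedStructure Z o₁ o₂ o₃ r) where

  open RankedStructure 𝒵 using (_≺_; order; f; ranked)
  open StrictTotalOrder order using (_<_; _<?_; compare; irrefl; trans; <-respˡ-≈; module Eq)

  private
    ≺⇒< : ∀ {u v} → u ≺ v → f u < f v
    ≺⇒< = Equivalence.to (ranked _ _)

    <⇒≺ : ∀ {u v} → f u < f v → u ≺ v
    <⇒≺ = Equivalence.from (ranked _ _)

  ≺-irrefl : ∀ {u} → ¬ u ≺ u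
  ≺-irrefl u≺u = irrefl Eq.refl (≺⇒< u≺u)

  ≺-trans : ∀ {u v w} → u ≺ v → v ≺ w → u ≺ w
  ≺-trans u≺v v≺w = <⇒≺ (trans (≺⇒< u≺v) (≺⇒< v≺w))

  _≺?_ : Decidable _≺_
  u ≺? v = map′ <⇒≺ ≺⇒< (f u <? f v)

  ≺-cotrans : ∀ {u w} v → u ≺ w → u ≺ v ⊎ v ≺ w
  ≺-cotrans {u} v u≺w with compare (f u) (f v)
  ... | tri< u<v _ _ = inj₁ (<⇒≺ u<v)
  ... | tri≈ _ u≈v _ = inj₂ (<⇒≺ (<-respˡ-≈ u≈v (≺⇒< u≺w)))
  ... | tri> _ _ v<u = inj₂ (<⇒≺ (trans v<u (≺⇒< u≺w)))

  ≺-minimal : ∀ x xs → ∃ λ m → m ∈ₗ (x ∷ xs) × ∀ {y} → y ∈ₗ (x ∷ xs) → ¬ y ≺ m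
  ≺-minimal x [] = x , here refl , λ { (here refl) → ≺-irrefl ; (there ()) }
  ≺-minimal x (x′ ∷ xs) with ≺-minimal x′ xs
  ... | m , m∈ , m-min with x ≺? m
  ... | yes x≺m = x , here refl , λ
    { (here refl) → ≺-irrefl
    ; (there y∈) y≺x → m-min y∈ (≺-trans y≺x x≺m) }
  ... | no x⊀m = m , there m∈ , λ
    { (here refl) → x⊀m
    ; (there y∈) → m-min y∈ }

  μ𝒵-nonempty : ∀ {ℓx} {X : Pred Z ℓx} → Finite X → Satisfiable X → Satisfiable (μ𝒵 𝒵 X)
  μ𝒵-nonempty ([] , X⇔xs) (x , x∈) with Equivalence.to (X⇔xs x) x∈
  ... | ()
  μ𝒵-nonempty (x′ ∷ xs , X⇔xs) _ with ≺-minimal x′ xs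
  ... | m , m∈ , m-min = m , Equivalence.from (X⇔xs m) m∈
                           , λ { (y , y∈ , y≺m) → m-min (Equivalence.to (X⇔xs y) y∈) y≺m }

  μ𝒵-restrict : ∀ {ℓx ℓy} {X : Pred Z ℓx} {Y : Pred Z ℓy} → X ⊆ Y → (μ𝒵 𝒵 Y ∩ X) ⊆ μ𝒵 𝒵 X
  μ𝒵-restrict X⊆Y ((_ , x-min) , x∈) = x∈ , λ { (y , y∈ , y≺x) → x-min (y , X⊆Y y∈ , y≺x) }

  -- Rankedness is used only here: y ≺ w gives y ≺ z or z ≺ w, and z ∈ X rules out the latter.
  μ𝒵-extend : ∀ {ℓx ℓy} {X : Pred Z ℓx} {Y : Pred Z ℓy} → X ⊆ Y →
              Satisfiable (μ𝒵 𝒵 Y ∩ X) → μ𝒵 𝒵 X ⊆ μ𝒵 𝒵 Y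
  μ𝒵-extend X⊆Y (z , (_ , z-min) , z∈X) (w∈X , w-min) = X⊆Y w∈X , λ { (y , y∈Y , y≺w) →
    [ (λ y≺z → z-min (y , y∈Y , y≺z)) , (λ z≺w → w-min (z , z∈X , z≺w)) ] (≺-cotrans _ y≺w) }

module Soundness {ℓ ℓy o₁ o₂ o₃ r : Level} (lem : ∀ {a} → ExcludedMiddle a)
  {Z : Set ℓ} {𝒴 : Pred (Pred Z ℓ) ℓy} (∅∈ : ∅ℓ ∈ 𝒴)
  (cup : ClosedUnderFiniteUnions 𝒴) (sing : ContainsSingletons 𝒴)
  (μ : Pred Z ℓ → Pred Z ℓ) (𝒵 : RankedStructure Z o₁ o₂ o₃ r)
  (represents : ∀ U → U ∈ 𝒴 → IsOverbrace 𝒴 μ (μ𝒵 𝒵 U) (μ U)) where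

  open RankedStructureProperties 𝒵
  open Overbrace 𝒴 μ

  μ𝒵⊆μ : ∀ {U} → U ∈ 𝒴 → μ𝒵 𝒵 U ⊆ μ U
  μ𝒵⊆μ U∈ = IsOverbrace⇒⊆ (represents _ U∈)

  μ-finite⊆μ𝒵 : ∀ {U} → U ∈ 𝒴 → Finite U → μ U ⊆ μ𝒵 𝒵 U
  μ-finite⊆μ𝒵 U∈ U-finite with finite-subset∈𝒴 lem ∅∈ cup sing U-finite proj₁
  ... | S , S∈ , S⊆μ𝒵 , μ𝒵⊆S = S⊆μ𝒵 ∘ IsOverbrace⇒least (represents _ U∈) S∈ μ𝒵⊆S

  μ𝒵⊆μ₃ : ∀ {U} → μ𝒵 𝒵 U ⊆ μ₃ 𝒴 μ U
  μ𝒵⊆μ₃ x-min@(x∈ , _) = x∈ , λ y y∈ →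
    μ𝒵⊆μ (pair∈𝒴 cup sing _ y) (μ𝒵-restrict (λ { (inj₁ refl) → x∈ ; (inj₂ refl) → y∈ }) (x-min , inj₁ refl))

  sound-μ=fin : μ=fin 𝒴 μ
  sound-μ=fin X Y X∈ Y∈ X-finite Y-finite X⊆Y (z , z∈μY , z∈X) =
      (λ { (w∈μY , w∈X) → μ𝒵⊆μ X∈ (μ𝒵-restrict X⊆Y (μ-finite⊆μ𝒵 Y∈ Y-finite w∈μY , w∈X)) })
    , λ w∈μX → μ𝒵⊆μ Y∈ (μ𝒵-extend X⊆Y (z , μ-finite⊆μ𝒵 Y∈ Y-finite z∈μY , z∈X)
                                      (μ-finite⊆μ𝒵 X∈ X-finite w∈μX))
             , proj₁ (μ-finite⊆μ𝒵 X∈ X-finite w∈μX)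

  sound-μ∈ : μ∈ 𝒴 μ
  sound-μ∈ X X∈ a (a∈X , a∉μX) with decidable-stable lem (λ ¬below → a∉μX (μ𝒵⊆μ X∈ (a∈X , ¬below)))
  ... | b , b∈X , b≺a = b , b∈X , λ a∈μab →
    proj₂ (μ-finite⊆μ𝒵 (pair∈𝒴 cup sing a b) (pair-finite a b) a∈μab) (b , inj₂ refl , b≺a)

  sound-μPR3 : μPR3 𝒴 μ
  sound-μPR3 U U∈ (X , X∈ , core⊆X , _ , μU⊈X) =
    μU⊈X (IsOverbrace⇒least (represents U U∈) X∈ λ x-min →
      core⊆X (μ𝒵⊆μ U∈ x-min , λ { (_ , x∉μ₃) → x∉μ₃ (μ𝒵⊆μ₃ x-min) }))

  sound-μ∅fin : μ∅fin 𝒴 μ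
  sound-μ∅fin X X∈ X-finite X≠∅ = map₂ (μ𝒵⊆μ X∈) (μ𝒵-nonempty X-finite X≠∅)

  sound : AllConditions 𝒴 μ
  sound = sound-μ=fin , sound-μ∈ , sound-μPR3 , sound-μ∅fin

module _ {a ℓ : Level} {A : Set a} {_≼_ : Rel A ℓ}
         (≼-total : Total _≼_) (≼-trans : Transitive _≼_) (_≼?_ : Decidable _≼_) where

  ≼-strictTotalOrder : StrictTotalOrder a ℓ ℓ
  ≼-strictTotalOrder = record
    { Carrier = A
    ; _≈_ = λ x y → x ≼ y × y ≼ x
    ; _<_ = λ x y → ¬ y ≼ x
    ; isStrictTotalOrder = record
      { isStrictPartialOrder = record
        { isEquivalence = record
          { refl = ≼-refl , ≼-refl
          ; sym = λ (x≼y , y≼x) → y≼x , x≼y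
          ; trans = λ (x≼y , y≼x) (y≼z , z≼y) → ≼-trans x≼y y≼z , ≼-trans z≼y y≼x }
        ; irrefl = λ (_ , y≼x) y⋠x → y⋠x y≼x
        ; trans = λ {x} {y} y⋠x z⋠y z≼x → [ z⋠y ∘ ≼-trans z≼x , y⋠x ] (≼-total x y)
        ; <-resp-≈ = (λ (y≼z , _) y⋠x z≼x → y⋠x (≼-trans y≼z z≼x))
                   , (λ (_ , z≼y) x⋠y x≼z → x⋠y (≼-trans x≼z z≼y))
        }
      ; compare = compare
      }
    }
    where
    ≼-refl : ∀ {x} → x ≼ x
    ≼-refl {x} = [ id , id ] (≼-total x x)

    compare : ∀ x y → Tri (¬ y ≼ x) (x ≼ y × y ≼ x) (¬ x ≼ y)
    compare x y with y ≼? x | x ≼? y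
    ... | no y⋠x | _      = tri< y⋠x (y⋠x ∘ proj₂) (λ x⋠y → [ x⋠y , y⋠x ] (≼-total x y))
    ... | yes y≼x | yes x≼y = tri≈ (λ y⋠x → y⋠x y≼x) (x≼y , y≼x) (λ x⋠y → x⋠y x≼y)
    ... | yes y≼x | no x⋠y  = tri> (λ y⋠x → y⋠x y≼x) (x⋠y ∘ proj₁) x⋠y

module Representation {ℓ ℓy : Level} (lem : ∀ {a} → ExcludedMiddle a)
  {Z : Set ℓ} {𝒴 : Pred (Pred Z ℓ) ℓy} (cap : ClosedUnderIntersections 𝒴)
  (cup : ClosedUnderFiniteUnions 𝒴) (sing : ContainsSingletons 𝒴)
  (μ : Pred Z ℓ → Pred Z ℓ) (choice : IsChoiceFunction 𝒴 μ)
  (μ=fin-holds : μ=fin 𝒴 μ) (μ∈-holds : μ∈ 𝒴 μ) (μPR3-holds : μPR3 𝒴 μ) (μ∅fin-holds : μ∅fin 𝒴 μ)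
  where

  open Overbrace 𝒴 μ

  private
    μ∈𝒴 : ∀ X → X ∈ 𝒴 → μ X ∈ 𝒴
    μ∈𝒴 = proj₁ choice

    stable : ∀ {p} {P : Set p} → ¬ ¬ P → P
    stable = decidable-stable lem

  μ-least-above-μ₃ : ∀ {U X} → U ∈ 𝒴 → X ∈ 𝒴 → μ₃ 𝒴 μ U ⊆ X → μ U ⊆ X
  μ-least-above-μ₃ {U} {X} U∈ X∈ μ₃⊆X {x} x∈μU = stable λ x∉X →
    let W , W∈ , W⊆ , W⊇ = ∩∈𝒴 cap (μ∈𝒴 U U∈) X∈ in
    μPR3-holds U U∈ (W , W∈
      , (λ (y∈μU , not-outside) → W⊇ (y∈μU , μ₃⊆X (stable λ y∉μ₃ → not-outside (y∈μU , y∉μ₃))))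
      , proj₁ ∘ W⊆
      , λ μU⊆W → x∉X (proj₂ (W⊆ (μU⊆W x∈μU))))

  μ⊆ : ∀ {U} → U ∈ 𝒴 → μ U ⊆ U
  μ⊆ U∈ = μ-least-above-μ₃ U∈ U∈ proj₁

  μ₃⊆μ : ∀ {U} → U ∈ 𝒴 → μ₃ 𝒴 μ U ⊆ μ U
  μ₃⊆μ {U} U∈ {x} (x∈U , x-wins) = stable λ x∉μU →
    let b , b∈U , x∉μxb = μ∈-holds U U∈ x (x∈U , x∉μU) in x∉μxb (x-wins b b∈U)

  _≼_ : Rel Z ℓ
  x ≼ y = x ∈ μ (pair x y)

  ≼-total : Total _≼_
  ≼-total x y with μ∅fin-holds (pair x y) (pair∈𝒴 cup sing x y) (pair-finite x y) (x , inj₁ refl)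
  ... | z , z∈μxy with μ⊆ (pair∈𝒴 cup sing x y) z∈μxy
  ... | inj₁ refl = inj₁ z∈μxy
  ... | inj₂ refl = inj₂ (proj₁ (proj₂ choice _ _ (pair∈𝒴 cup sing x y) (∪-comm _ _)) z∈μxy)

  module _ {Y} (Y∈ : Y ∈ 𝒴) (Y-finite : Finite Y) {x y} (xy⊆Y : pair x y ⊆ Y) where

    private
      restrict : Satisfiable (μ Y ∩ pair x y) → (μ Y ∩ pair x y) ≐ μ (pair x y)
      restrict = μ=fin-holds (pair x y) Y (pair∈𝒴 cup sing x y) Y∈ (pair-finite x y) Y-finite xy⊆Y

    μ⇒≼ : x ∈ μ Y → x ≼ y
    μ⇒≼ x∈μY = proj₁ (restrict (x , x∈μY , inj₁ refl)) (x∈μY , inj₁ refl)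

    ≼⇒μ : x ≼ y → y ∈ μ Y → x ∈ μ Y
    ≼⇒μ x≼y y∈μY = proj₁ (proj₂ (restrict (y , y∈μY , inj₂ refl)) x≼y)

  ≼-trans : Transitive _≼_
  ≼-trans {x} {y} {z} x≼y y≼z = μ⇒≼ Y∈ Y-finite [ inj₁ ∘ inj₁ , inj₂ ] x∈μY
    where
    Y : Pred Z ℓ
    Y = pair x y ∪ ⟦ z ⟧

    Y∈ : Y ∈ 𝒴
    Y∈ = cup _ _ (pair∈𝒴 cup sing x y) (sing z)

    Y-finite : Finite Y
    Y-finite = ∪-finite (pair-finite x y) (⟦⟧-finite z)

    x∈μ : ∀ {w} → w ∈ μ Y → w ∈ Y → x ∈ μ Y
    x∈μ w∈μY (inj₁ (inj₁ refl)) = w∈μY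
    x∈μ w∈μY (inj₁ (inj₂ refl)) = ≼⇒μ Y∈ Y-finite inj₁ x≼y w∈μY
    x∈μ w∈μY (inj₂ refl) = ≼⇒μ Y∈ Y-finite inj₁ x≼y (≼⇒μ Y∈ Y-finite [ inj₁ ∘ inj₂ , inj₂ ] y≼z w∈μY)

    x∈μY : x ∈ μ Y
    x∈μY = let w , w∈μY = μ∅fin-holds Y Y∈ Y-finite (x , inj₁ (inj₁ refl)) in x∈μ w∈μY (μ⊆ Y∈ w∈μY)

  𝒵 : RankedStructure Z ℓ ℓ ℓ ℓ
  𝒵 = record
    { _≺_ = λ x y → ¬ y ≼ x
    ; order = ≼-strictTotalOrder ≼-total ≼-trans (λ x y → lem)
    ; f = id
    ; ranked = λ _ _ → mk⇔ id id
    }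

  μ𝒵⊆μ₃ : ∀ {U} → μ𝒵 𝒵 U ⊆ μ₃ 𝒴 μ U
  μ𝒵⊆μ₃ (x∈U , x-min) = x∈U , λ y y∈U → stable λ x⋠y → x-min (y , y∈U , x⋠y)

  μ₃⊆μ𝒵 : ∀ {U} → μ₃ 𝒴 μ U ⊆ μ𝒵 𝒵 U
  μ₃⊆μ𝒵 (x∈U , x-wins) = x∈U , λ (y , y∈U , x⋠y) → x⋠y (x-wins y y∈U)

  represents : ∀ U → U ∈ 𝒴 → IsOverbrace 𝒴 μ (μ𝒵 𝒵 U) (μ U)
  represents U U∈ = least⇒IsOverbrace (μ∈𝒴 U U∈) (μ₃⊆μ U∈ ∘ μ𝒵⊆μ₃)
    λ X∈ μ𝒵⊆X → μ-least-above-μ₃ U∈ X∈ (μ𝒵⊆X ∘ μ₃⊆μ𝒵)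

proposition4p15 :
    ∀ {ℓ ℓy o₁ o₂ o₃ r : Level} →
    (lem : ∀ {a} → ExcludedMiddle a) →
    (Z : Set ℓ) (𝒴 : Pred (Pred Z ℓ) ℓy) →
    Extensional 𝒴 → ClosedUnderIntersections 𝒴 → ClosedUnderFiniteUnions 𝒴 →
    ContainsSingletons 𝒴 → ∅ℓ ∈ 𝒴 → Zℓ ∈ 𝒴 →
    (μ : Pred Z ℓ → Pred Z ℓ) → IsChoiceFunction 𝒴 μ →
    (AllConditions 𝒴 μ →
       Σ (RankedStructure Z ℓ ℓ ℓ ℓ) λ 𝒵 →
         ∀ U → U ∈ 𝒴 → IsOverbrace 𝒴 μ (μ𝒵 𝒵 U) (μ U))
    ×
    ((𝒵 : RankedStructure Z o₁ o₂ o₃ r) →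
       (∀ U → U ∈ 𝒴 → IsOverbrace 𝒴 μ (μ𝒵 𝒵 U) (μ U)) →
       AllConditions 𝒴 μ)
proposition4p15 lem Z 𝒴 _ cap cup sing ∅∈ _ μ choice =
    (λ (μ=fin-holds , μ∈-holds , μPR3-holds , μ∅fin-holds) →
       let open Representation lem cap cup sing μ choice μ=fin-holds μ∈-holds μPR3-holds μ∅fin-holds
       in 𝒵 , represents)
  , (λ 𝒵 represents → Soundness.sound lem ∅∈ cup sing μ 𝒵 represents)
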